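{- In any of the calculi CCS, ABC, ABCd, CCSS, CCSS$'$ described below, the relation $\leadsto$ on $\mathit{Tr}^{s\bullet}$ is reflexive and transitive, and for all $t,u\in\mathit{Tr}^\bullet$ it is not the case that both $t\leadsto u$ and $t\smile^{\bullet}u$.
   Context: Fix sets $\mathcal A$ (agent identifiers), $\mathcal C$ (handshake names), $\mathcal B$ (broadcast names), $\mathcal S$ (signals); $\bar{\mathcal C}=\{\bar c\mid c\in\mathcal C\}$, $\bar{\mathcal S}=\{\bar s\mid s\in\mathcal S\}$, $\bar{\bar x}=x$. Processes: $P::=\mathbf 0\mid\alpha.P\mid P+P\mid P|P\mid P\backslash L\mid P[f]\mid A$, and in CCSS, CCSS$'$ also $P\,\hat{}\,s$ ($s\in\mathcal S$); each $A\in\mathcal A$ has an equation $A\stackrel{def}{=}P_A$ (guarded in ABC, ABCd: every agent identifier within the scope of a prefix); $L\subseteq\mathcal C$ ($L\subseteq\mathcal C\cup\mathcal S$ in CCSS, CCSS$'$); $f$ maps $\mathcal C\to\mathcal C$, $\mathcal B\to\mathcal B$, $\mathcal S\to\mathcal S$, extended by $f(\bar c)=\overline{f(c)}$, $f(b!)=f(b)!$, $f(b?)=f(b)?$, $f(\tau)=\tau$. Actions $\mathit{Act}$/labels $\mathcal L$: CCS: $\mathit{Act}=\mathcal L=\mathcal C\cup\bar{\mathcal C}\cup\{\tau\}$; ABC: $\mathit{Act}=\mathcal L=\{b!,b?\mid b\in\mathcal B\}\cup\mathcal C\cup\bar{\mathcal C}\cup\{\tau\}$; ABCd: same $\mathit{Act}$,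 $\mathcal L=\mathit{Act}\cup\{b{:}\mid b\in\mathcal B\}$; CCSS: $\mathit{Act}=\mathcal L=\mathcal S\cup\mathcal C\cup\bar{\mathcal C}\cup\{\tau\}$; CCSS$'$: same $\mathit{Act}$, $\mathcal L=\mathit{Act}\cup\bar{\mathcal S}$. Receptive set $R=\{b?\mid b\in\mathcal B\}$ in ABC, ABCd, $R=\emptyset$ otherwise. Rules (all calculi): $\alpha.P\xrightarrow{\alpha}P$; from $P\xrightarrow{\alpha}P'$: $P+Q\xrightarrow{\alpha}P'$ and $Q+P\xrightarrow{\alpha}P'$; from $P\xrightarrow{\eta}P'$: $P|Q\xrightarrow{\eta}P'|Q$ and $Q|P\xrightarrow{\eta}Q|P'$; from $P\xrightarrow{c}P'$, $Q\xrightarrow{\bar c}Q'$: $P|Q\xrightarrow{\tau}P'|Q'$; from $P\xrightarrow{\ell}P'$: $P\backslash L\xrightarrow{\ell}P'\backslash L$ if $\ell\notin L\cup\bar L$, and $P[f]\xrightarrow{f(\ell)}P'[f]$; from $P_A\xrightarrow{\alpha}P'$: $A\xrightarrow{\alpha}P'$. Here $\alpha\in\mathit{Act}$, $\ell\in\mathcal L$, $c\in\mathcal C\cup\bar{\mathcal C}$ (in CCSS$'$: $c\in\mathcal C\cup\bar{\mathcal C}\cup\mathcal S\cup\bar{\mathcal S}$), and $\eta$ ranges over $\mathcal C\cup\bar{\mathcal C}\cup\{\tau\}$ in ABC/ABCd, over $\mathit{Act}$ in CCS/CCSS, over $\mathcal L$ in CCSS$'$. ABC adds: from $P\xrightarrow{b\sharp_1}P'$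 and $Q$ having no $b?$-transition: $P|Q\xrightarrow{b\sharp_1}P'|Q$ and $Q|P\xrightarrow{b\sharp_1}Q|P'$; from $P\xrightarrow{b\sharp_1}P'$, $Q\xrightarrow{b\sharp_2}Q'$: $P|Q\xrightarrow{b\sharp}P'|Q'$ where $\sharp=\sharp_1\circ\sharp_2$ with $!\circ?=?\circ!=!$, $?\circ?=?$, $!\circ!$ undefined. ABCd adds (instead): $\mathbf 0\xrightarrow{b:}\mathbf 0$; $\alpha.P\xrightarrow{b:}\alpha.P$ if $\alpha\ne b?$; from $P\xrightarrow{b:}P'$, $Q\xrightarrow{b:}Q'$: $P+Q\xrightarrow{b:}P'+Q'$; the synchronisation rule above with $\sharp_i\in\{!,?,:\}$ and additionally $!\circ:=:\circ!=!$, $?\circ:=:\circ?=?$, $:\circ:=:$; from $P_A\xrightarrow{b:}P'$: $A\xrightarrow{b:}A$. CCSS adds a predicate $P\curvearrowright s$: $(P\,\hat{}\,s)\curvearrowright s$; from $P\curvearrowright s$: $(P+Q),(Q+P),(P|Q),(Q|P),(P\,\hat{}\,r)\curvearrowright s$, $(P\backslash L)\curvearrowright s$ if $s\notin L$, $P[f]\curvearrowright f(s)$, and $A\curvearrowright s$ if $P=P_A$; and transitions: from $P\xrightarrow{\alpha}P'$: $P\,\hat{}\,r\xrightarrow{\alpha}P'$; from $P\curvearrowright s$, $Q\xrightarrow{s}Q'$: $P|Q\xrightarrow{\tau}P|Q'$; from $P\xrightarrow{s}P'$, $Q\curvearrowright s$: $P|Q\xrightarrow{\tau}P'|Q$. CCSS$'$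 adds: $P\,\hat{}\,s\xrightarrow{\bar s}P\,\hat{}\,s$; from $P\xrightarrow{\bar s}P'$: $P+Q\xrightarrow{\bar s}P'+Q$ and $Q+P\xrightarrow{\bar s}Q+P'$; from $P\xrightarrow{\alpha}P'$: $P\,\hat{}\,r\xrightarrow{\alpha}P'$; from $P\xrightarrow{\bar s}P'$: $P\,\hat{}\,r\xrightarrow{\bar s}P'\,\hat{}\,r$; from $P_A\xrightarrow{\bar s}P'$: $A\xrightarrow{\bar s}A$. $\mathit{Tr}$ is the set of derivations (proof trees) of transitions, with source, target, label of the derived transition; derivations are named: $\overset{\alpha}{\to}P$ (prefix axiom), $\chi+Q$, $P+\chi$, $\chi|Q$, $P|\zeta$, $\chi|\zeta$ (any binary synchronisation, incl. signal/broadcast), $\chi\backslash L$, $\chi[f]$, $A{:}\chi$, $\chi\,\hat{}\,r$; emission derivations $P\!\uparrow\!s$ (axiom) and lifted ones named likewise; ABCd: $b{:}\mathbf 0$, $b{:}\alpha.P$, $\chi+v$ (discard sum). An emission derivation of $P\curvearrowright s$ has source $P$ and label $\bar s$. $\mathit{Tr}^\bullet$: derivations with label in $\mathit{Act}\setminus R$. $\mathit{Tr}^{s\bullet}$: emission derivations, transition derivations with label in $\bar{\mathcal S}$, and those with label in $\mathit{Act}\setminus\{b?\mid b\in\mathcal B\}$. Synchrons: with $\mathit{Arg}=\{+_L,+_R,|_L,|_R,\backslash L,[f],A{:},\hat{}\,r\}$, a synchron is $\sigma(\overset{\alpha}{\to}P)$, $\sigma(P\!\uparrow\!s)$ or $\sigma(b{:})$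 with $\sigma\in\mathit{Arg}^*$; prefixing an argument to a set applies it elementwise. $\varsigma(\overset{\alpha}{\to}P)=\{(\overset{\alpha}{\to}P)\}$, $\varsigma(P\!\uparrow\!s)=\{(P\!\uparrow\!s)\}$, $\varsigma(b{:}\mathbf 0)=\varsigma(b{:}\alpha.P)=\{(b{:})\}$, $\varsigma(\chi+Q)=+_L\varsigma(\chi)$, $\varsigma(P+\chi)=+_R\varsigma(\chi)$, $\varsigma(\chi+v)=+_L\varsigma(\chi)\cup+_R\varsigma(v)$, $\varsigma(\chi|Q)=|_L\varsigma(\chi)$, $\varsigma(P|\zeta)=|_R\varsigma(\zeta)$, $\varsigma(\chi|\zeta)=|_L\varsigma(\chi)\cup|_R\varsigma(\zeta)$, $\varsigma(\chi\backslash L)=\backslash L\,\varsigma(\chi)$, $\varsigma(\chi[f])=[f]\varsigma(\chi)$, $\varsigma(A{:}\chi)=A{:}\varsigma(\chi)$, $\varsigma(\chi\,\hat{}\,r)=\hat{}\,r\,\varsigma(\chi)$. Active synchrons $a\varsigma(\chi)$: those of form $\sigma(\overset{\alpha}{\to}P)$. For $\chi\in\mathit{Tr}^{s\bullet}$, necessary synchrons $n\varsigma(\chi)$: if $\ell(\chi)=b!$, the unique synchron of form $\sigma(\overset{b!}{\to}P)$; otherwise $\varsigma(\chi)$. Arguments $+_L,+_R,A{:},\hat{}\,r$ are dynamic, others static; $\mathrm{static}(\sigma)$ deletes dynamic arguments (leaves kept). For strings $x,x'$: $x\leadsto x'$ iff $x'=x$ or $x=\sigma_1|_Dx_2$, $x'=\mathrm{static}(\sigma_1)|_Dx_2$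 ($D\in\{L,R\}$); $x\smile_d y$ iff $x=\sigma_1|_Dx_2$, $y=\sigma_1|_Ey_2$ with $\{D,E\}=\{L,R\}$; $x\smile y$ iff $x_0\leadsto x$, $x_0\smile_d y_0$, $y_0\leadsto y$ for some $x_0,y_0$. For $\chi,\chi'\in\mathit{Tr}^{s\bullet}$: $\chi\leadsto\chi'$ iff $|n\varsigma(\chi)|=|n\varsigma(\chi')|$ and each $\varsigma'\in n\varsigma(\chi')$ has $\varsigma\in n\varsigma(\chi)$ with $\varsigma\leadsto\varsigma'$. For $\chi\in\mathit{Tr}^{s\bullet}$, $\zeta\in\mathit{Tr}$: $\chi\smile^{\bullet}\zeta$ iff $\varsigma\smile\upsilon$ for all $\varsigma\in n\varsigma(\chi)$, $\upsilon\in a\varsigma(\zeta)$. -}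

module Defs where

open import Level using (0ℓ)
open import Data.Unit using (⊤; tt)
open import Data.Empty using (⊥)
open import Data.Bool using (Bool; true; false)
open import Data.Sum using (_⊎_; inj₁; inj₂)
open import Data.Product using (Σ; _×_; _,_; proj₁; proj₂; ∃; ∃-syntax)
open import Data.List using (List; []; _∷_; _++_; map; length)
open import Data.List.Membership.Propositional using (_∈_)
open import Relation.Unary using (Pred)
open import Relation.Nullary using (¬_)
open import Relation.Binary.PropositionalEquality using (_≡_; _≢_)

data Calc : Set where
  CCS ABC ABCd CCSS CCSS' : Calc

HasB : Calc → Set          -- broadcast actions b!, b?  (ABC, ABCd)
HasB ABC  = ⊤
HasB ABCd = ⊤
HasB _    = ⊥

HasD : Calc → Set          -- discard labels b:  (ABCd)
HasD ABCd = ⊤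
HasD _    = ⊥

HasS : Calc → Set          -- signals, signal operator P ^ s  (CCSS, CCSS')
HasS CCSS  = ⊤
HasS CCSS' = ⊤
HasS _     = ⊥

HasS' : Calc → Set         -- emission labels s̄  (CCSS')
HasS' CCSS' = ⊤
HasS' _     = ⊥

IsABC : Calc → Set
IsABC ABC = ⊤
IsABC _   = ⊥

IsCCSS : Calc → Set
IsCCSS CCSS = ⊤
IsCCSS _    = ⊥

NeedsGuard : Calc → Set
NeedsGuard ABC  = ⊤
NeedsGuard ABCd = ⊤
NeedsGuard _    = ⊥

module Calculus (𝒜 𝒞 ℬ 𝒮 : Set) where

  RName : Calc → Set
  RName CCSS  = 𝒞 ⊎ 𝒮
  RName CCSS' = 𝒞 ⊎ 𝒮
  RName _     = 𝒞

  data Act (c : Calc) : Set where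
    ch  : 𝒞 → Act c
    co  : 𝒞 → Act c
    τ   : Act c
    out : HasB c → ℬ → Act c
    inp : HasB c → ℬ → Act c
    sg  : HasS c → 𝒮 → Act c     -- s  (signal reception)

  data Lab (c : Calc) : Set where
    act  : Act c → Lab c
    disc : HasD c → ℬ → Lab c
    em   : HasS' c → 𝒮 → Lab c

  record Ren : Set where
    constructor ren
    field
      fC : 𝒞 → 𝒞
      fB : ℬ → ℬ
      fS : 𝒮 → 𝒮
  open Ren public

  renAct : ∀ {c} → Ren → Act c → Act c
  renAct f (ch a)    = ch (fC f a)
  renAct f (co a)    = co (fC f a)
  renAct f τ         = τ
  renAct f (out h b) = out h (fB f b)
  renAct f (inp h b) = inp h (fB f b)
  renAct f (sg h s)  = sg h (fS f s)

  renLab : ∀ {c} → Ren → Lab c → Lab c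
  renLab f (act α)    = act (renAct f α)
  renLab f (disc h b) = disc h (fB f b)
  renLab f (em h s)   = em h (fS f s)

  data Proc (c : Calc) : Set₁ where
    𝟎     : Proc c
    _∙_   : Act c → Proc c → Proc c
    _⊕_   : Proc c → Proc c → Proc c
    _∥_   : Proc c → Proc c → Proc c
    _∖_   : Proc c → Pred (RName c) 0ℓ → Proc c
    _[_]  : Proc c → Ren → Proc c
    agent : 𝒜 → Proc c
    sig   : HasS c → Proc c → 𝒮 → Proc c

  Guarded : ∀ {c} → Proc c → Set
  Guarded 𝟎           = ⊤
  Guarded (α ∙ P)     = ⊤
  Guarded (P ⊕ Q)     = Guarded P × Guarded Q
  Guarded (P ∥ Q)     = Guarded P × Guarded Q
  Guarded (P ∖ L)     = Guarded P
  Guarded (P [ f ])   = Guarded P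
  Guarded (agent A)   = ⊥
  Guarded (sig _ P s) = Guarded P

  GuardHyp : (c : Calc) → (𝒜 → Proc c) → Set
  GuardHyp c def = NeedsGuard c → (A : 𝒜) → Guarded (def A)

  Blocked : (c : Calc) → Pred (RName c) 0ℓ → Lab c → Set
  Blocked CCS   L (act (ch a)) = L a
  Blocked CCS   L (act (co a)) = L a
  Blocked ABC   L (act (ch a)) = L a
  Blocked ABC   L (act (co a)) = L a
  Blocked ABCd  L (act (ch a)) = L a
  Blocked ABCd  L (act (co a)) = L a
  Blocked CCSS  L (act (ch a)) = L (inj₁ a)
  Blocked CCSS  L (act (co a)) = L (inj₁ a)
  Blocked CCSS  L (act (sg _ s)) = L (inj₂ s)
  Blocked CCSS' L (act (ch a)) = L (inj₁ a)
  Blocked CCSS' L (act (co a)) = L (inj₁ a)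
  Blocked CCSS' L (act (sg _ s)) = L (inj₂ s)
  Blocked CCSS' L (em _ s)     = L (inj₂ s)
  Blocked _     L _            = ⊥

  SigIn : (c : Calc) → Pred (RName c) 0ℓ → 𝒮 → Set
  SigIn CCSS  L s = L (inj₂ s)
  SigIn CCSS' L s = L (inj₂ s)
  SigIn _     L s = ⊥

  -- labels η allowed in the interleaving rule for |
  IsEta : (c : Calc) → Lab c → Set
  IsEta ABC  (act (ch _)) = ⊤
  IsEta ABC  (act (co _)) = ⊤
  IsEta ABC  (act τ)      = ⊤
  IsEta ABC  _            = ⊥
  IsEta ABCd (act (ch _)) = ⊤
  IsEta ABCd (act (co _)) = ⊤
  IsEta ABCd (act τ)      = ⊤
  IsEta ABCd _            = ⊥
  IsEta CCS   (act _) = ⊤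
  IsEta CCS   _       = ⊥
  IsEta CCSS  (act _) = ⊤
  IsEta CCSS  _       = ⊥
  IsEta CCSS' _       = ⊤

  IsRecv : ∀ {c} → ℬ → Act c → Set
  IsRecv b (inp _ b') = b' ≡ b
  IsRecv b _          = ⊥

  data BSync {c : Calc} : Lab c → Lab c → Lab c → Set where
    !? : ∀ {h h' b} → BSync (act (out h b)) (act (inp h' b)) (act (out h b))
    ?! : ∀ {h h' b} → BSync (act (inp h b)) (act (out h' b)) (act (out h' b))
    ?? : ∀ {h h' b} → BSync (act (inp h b)) (act (inp h' b)) (act (inp h b))
    !: : ∀ {h d b} → BSync (act (out h b)) (disc d b) (act (out h b))
    :! : ∀ {h d b} → BSync (disc d b) (act (out h b)) (act (out h b))
    ?: : ∀ {h d b} → BSync (act (inp h b)) (disc d b) (act (inp h b))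
    :? : ∀ {h d b} → BSync (disc d b) (act (inp h b)) (act (inp h b))
    :: : ∀ {d d' b} → BSync (disc d b) (disc d' b) (disc d b)

  module Sem (c : Calc) (def : 𝒜 → Proc c) where

    -- "P has a b?-transition" (ABC), as the least predicate closed under
    -- the rules producing b?-transitions
    data Recv (b : ℬ) : Proc c → Set₁ where
      pre   : ∀ {h P} → Recv b (inp h b ∙ P)
      sumL  : ∀ {P} Q → Recv b P → Recv b (P ⊕ Q)
      sumR  : ∀ P {Q} → Recv b Q → Recv b (P ⊕ Q)
      parL  : ∀ {P} Q → Recv b P → Recv b (P ∥ Q)
      parR  : ∀ P {Q} → Recv b Q → Recv b (P ∥ Q)
      res   : ∀ {P} L → Recv b P → Recv b (P ∖ L)     -- b? ∉ L ∪ L̄ as L ⊆ 𝒞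
      rn    : ∀ {P b'} f → Recv b' P → fB f b' ≡ b → Recv b (P [ f ])
      ag    : ∀ A → Recv b (def A) → Recv b (agent A)
      sg    : ∀ {h P} r → Recv b P → Recv b (sig h P r)

    data Emit : Proc c → 𝒮 → Set₁ where
      ↑     : ∀ {h} P s → Emit (sig h P s) s
      sumL  : ∀ {P s} → Emit P s → ∀ Q → Emit (P ⊕ Q) s
      sumR  : ∀ {Q s} P → Emit Q s → Emit (P ⊕ Q) s
      parL  : ∀ {P s} → Emit P s → ∀ Q → Emit (P ∥ Q) s
      parR  : ∀ {Q s} P → Emit Q s → Emit (P ∥ Q) s
      sigr  : ∀ {h P s} → Emit P s → ∀ r → Emit (sig h P r) s
      res   : ∀ {P s} → Emit P s → ∀ L → ¬ SigIn c L s → Emit (P ∖ L) s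
      rn    : ∀ {P s} → Emit P s → ∀ f → Emit (P [ f ]) (fS f s)
      ag    : ∀ {s} A → Emit (def A) s → Emit (agent A) s

    data Step : Proc c → Lab c → Proc c → Set₁ where
      pre    : ∀ α P → Step (α ∙ P) (act α) P
      sumL   : ∀ {P α P'} → Step P (act α) P' → ∀ Q → Step (P ⊕ Q) (act α) P'
      sumR   : ∀ {Q α Q'} P → Step Q (act α) Q' → Step (P ⊕ Q) (act α) Q'
      parL   : ∀ {P η P'} → Step P η P' → IsEta c η → ∀ Q → Step (P ∥ Q) η (P' ∥ Q)
      parR   : ∀ {Q η Q'} P → Step Q η Q' → IsEta c η → Step (P ∥ Q) η (P ∥ Q')
      comL   : ∀ {P P' Q Q' a} → Step P (act (ch a)) P' → Step Q (act (co a)) Q'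
               → Step (P ∥ Q) (act τ) (P' ∥ Q')
      comR   : ∀ {P P' Q Q' a} → Step P (act (co a)) P' → Step Q (act (ch a)) Q'
               → Step (P ∥ Q) (act τ) (P' ∥ Q')
      comSL  : ∀ {P P' Q Q' h h' s} → Step P (act (sg h s)) P' → Step Q (em h' s) Q'
               → Step (P ∥ Q) (act τ) (P' ∥ Q')
      comSR  : ∀ {P P' Q Q' h h' s} → Step P (em h' s) P' → Step Q (act (sg h s)) Q'
               → Step (P ∥ Q) (act τ) (P' ∥ Q')
      res    : ∀ {P ℓ P'} → Step P ℓ P' → ∀ L → ¬ Blocked c L ℓ → Step (P ∖ L) ℓ (P' ∖ L)
      rn     : ∀ {P ℓ P'} → Step P ℓ P' → ∀ f → Step (P [ f ]) (renLab f ℓ) (P' [ f ])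
      ag     : ∀ {α P'} A → Step (def A) (act α) P' → Step (agent A) (act α) P'
      bcOutL : ∀ {P P' h b} → IsABC c → Step P (act (out h b)) P' → ∀ Q → ¬ Recv b Q
               → Step (P ∥ Q) (act (out h b)) (P' ∥ Q)
      bcInpL : ∀ {P P' h b} → IsABC c → Step P (act (inp h b)) P' → ∀ Q → ¬ Recv b Q
               → Step (P ∥ Q) (act (inp h b)) (P' ∥ Q)
      bcOutR : ∀ {Q Q' h b} → IsABC c → ∀ P → Step Q (act (out h b)) Q' → ¬ Recv b P
               → Step (P ∥ Q) (act (out h b)) (P ∥ Q')
      bcInpR : ∀ {Q Q' h b} → IsABC c → ∀ P → Step Q (act (inp h b)) Q' → ¬ Recv b P
               → Step (P ∥ Q) (act (inp h b)) (P ∥ Q')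
      bsync  : ∀ {P P' Q Q' ℓ₁ ℓ₂ ℓ} → Step P ℓ₁ P' → Step Q ℓ₂ Q' → BSync ℓ₁ ℓ₂ ℓ
               → Step (P ∥ Q) ℓ (P' ∥ Q')
      disc𝟎  : ∀ {h b} → Step 𝟎 (disc h b) 𝟎
      discα  : ∀ {h b} α P → ¬ IsRecv b α → Step (α ∙ P) (disc h b) (α ∙ P)
      discΣ  : ∀ {P P' Q Q' h b} → Step P (disc h b) P' → Step Q (disc h b) Q'
               → Step (P ⊕ Q) (disc h b) (P' ⊕ Q')
      discA  : ∀ {h b P'} A → Step (def A) (disc h b) P' → Step (agent A) (disc h b) (agent A)
      sigα   : ∀ {h P α P'} → Step P (act α) P' → ∀ r → Step (sig h P r) (act α) P'
      sigSL  : ∀ {P Q Q' h s} → IsCCSS c → Emit P s → Step Q (act (sg h s)) Q'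
               → Step (P ∥ Q) (act τ) (P ∥ Q')
      sigSR  : ∀ {P P' Q h s} → IsCCSS c → Step P (act (sg h s)) P' → Emit Q s
               → Step (P ∥ Q) (act τ) (P' ∥ Q)
      ↑      : ∀ {h h'} P s → Step (sig h P s) (em h' s) (sig h P s)
      emSumL : ∀ {P P' h s} → Step P (em h s) P' → ∀ Q → Step (P ⊕ Q) (em h s) (P' ⊕ Q)
      emSumR : ∀ {Q Q' h s} P → Step Q (em h s) Q' → Step (P ⊕ Q) (em h s) (P ⊕ Q')
      emSig  : ∀ {h h' P P' s} → Step P (em h' s) P' → ∀ r
               → Step (sig h P r) (em h' s) (sig h P' r)
      emA    : ∀ {h s P'} A → Step (def A) (em h s) P' → Step (agent A) (em h s) (agent A)

    record Tr : Set₁ where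
      constructor tr
      field
        {src} : Proc c
        {lab} : Lab c
        {tgt} : Proc c
        der   : Step src lab tgt

    Bullet : Lab c → Set
    Bullet (act (inp _ _)) = ⊥
    Bullet (act _)         = ⊤
    Bullet _               = ⊥

    SBullet : Lab c → Set
    SBullet (act (inp _ _)) = ⊥
    SBullet (act _)         = ⊤
    SBullet (em _ _)        = ⊤
    SBullet (disc _ _)      = ⊥

    Bullet⇒SBullet : ∀ ℓ → Bullet ℓ → SBullet ℓ
    Bullet⇒SBullet (act (ch _))  _ = tt
    Bullet⇒SBullet (act (co _))  _ = tt
    Bullet⇒SBullet (act τ)       _ = tt
    Bullet⇒SBullet (act (out _ _)) _ = tt
    Bullet⇒SBullet (act (sg _ _)) _ = tt

    data TrS : Set₁ where
      trS   : (t : Tr) → SBullet (Tr.lab t) → TrS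
      emitS : IsCCSS c → ∀ {P s} → Emit P s → TrS

    record TrB : Set₁ where
      constructor trB
      field
        t  : Tr
        ok : Bullet (Tr.lab t)

    TrB→TrS : TrB → TrS
    TrB→TrS (trB t ok) = trS t (Bullet⇒SBullet (Tr.lab t) ok)

  module Synchrons (c : Calc) (def : 𝒜 → Proc c) where
    open Sem c def

    data Arg : Set₁ where
      +L +R |L |R : Arg
      ∖A   : Pred (RName c) 0ℓ → Arg
      renA : Ren → Arg
      agA  : 𝒜 → Arg
      sigA : 𝒮 → Arg

    data Leaf : Set₁ where
      preL  : Act c → Proc c → Leaf
      emitL : Proc c → 𝒮 → Leaf
      discL : ℬ → Leaf

    Synchron : Set₁
    Synchron = List Arg × Leaf

    infixr 5 _◂_ _◂*_
    _◂_ : Arg → Synchron → Synchron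
    a ◂ (σ , l) = (a ∷ σ , l)

    _◂*_ : Arg → List Synchron → List Synchron
    a ◂* xs = map (a ◂_) xs

    leaf : Leaf → List Synchron
    leaf l = ([] , l) ∷ []

    ςE : ∀ {P s} → Emit P s → List Synchron
    ςE (↑ P s)      = leaf (emitL P s)
    ςE (sumL χ Q)   = +L ◂* ςE χ
    ςE (sumR P χ)   = +R ◂* ςE χ
    ςE (parL χ Q)   = |L ◂* ςE χ
    ςE (parR P χ)   = |R ◂* ςE χ
    ςE (sigr χ r)   = sigA r ◂* ςE χ
    ςE (res χ L _)  = ∖A L ◂* ςE χ
    ςE (rn χ f)     = renA f ◂* ςE χ
    ςE (ag A χ)     = agA A ◂* ςE χ

    ςT : ∀ {P ℓ P'} → Step P ℓ P' → List Synchron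
    ςT (pre α P)         = leaf (preL α P)
    ςT (sumL χ Q)        = +L ◂* ςT χ
    ςT (sumR P χ)        = +R ◂* ςT χ
    ςT (parL χ _ Q)      = |L ◂* ςT χ
    ςT (parR P χ _)      = |R ◂* ςT χ
    ςT (comL χ ζ)        = (|L ◂* ςT χ) ++ (|R ◂* ςT ζ)
    ςT (comR χ ζ)        = (|L ◂* ςT χ) ++ (|R ◂* ςT ζ)
    ςT (comSL χ ζ)       = (|L ◂* ςT χ) ++ (|R ◂* ςT ζ)
    ςT (comSR χ ζ)       = (|L ◂* ςT χ) ++ (|R ◂* ςT ζ)
    ςT (res χ L _)       = ∖A L ◂* ςT χ
    ςT (rn χ f)          = renA f ◂* ςT χ
    ςT (ag A χ)          = agA A ◂* ςT χ
    ςT (bcOutL _ χ Q _)  = |L ◂* ςT χ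
    ςT (bcInpL _ χ Q _)  = |L ◂* ςT χ
    ςT (bcOutR _ P ζ _)  = |R ◂* ςT ζ
    ςT (bcInpR _ P ζ _)  = |R ◂* ςT ζ
    ςT (bsync χ ζ _)     = (|L ◂* ςT χ) ++ (|R ◂* ςT ζ)
    ςT (disc𝟎 {b = b})   = leaf (discL b)
    ςT (discα {b = b} α P _) = leaf (discL b)
    ςT (discΣ χ υ)       = (+L ◂* ςT χ) ++ (+R ◂* ςT υ)
    ςT (discA A χ)       = agA A ◂* ςT χ
    ςT (sigα χ r)        = sigA r ◂* ςT χ
    ςT (sigSL _ χ ζ)     = (|L ◂* ςE χ) ++ (|R ◂* ςT ζ)
    ςT (sigSR _ χ ζ)     = (|L ◂* ςT χ) ++ (|R ◂* ςE ζ)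
    ςT (↑ P s)           = leaf (emitL P s)
    ςT (emSumL χ Q)      = +L ◂* ςT χ
    ςT (emSumR P χ)      = +R ◂* ςT χ
    ςT (emSig χ r)       = sigA r ◂* ςT χ
    ςT (emA A χ)         = agA A ◂* ςT χ

    filterS : (Leaf → Bool) → List Synchron → List Synchron
    filterS p []             = []
    filterS p ((σ , l) ∷ xs) with p l
    ... | true  = (σ , l) ∷ filterS p xs
    ... | false = filterS p xs

    isPre : Leaf → Bool
    isPre (preL _ _) = true
    isPre _          = false

    isOutPre : Leaf → Bool
    isOutPre (preL (out _ _) _) = true
    isOutPre _                  = false

    aς : Tr → List Synchron
    aς (tr χ) = filterS isPre (ςT χ)

    nςT : ∀ {P ℓ P'} → Step P ℓ P' → List Synchron
    nςT {ℓ = act (out _ _)} χ = filterS isOutPre (ςT χ)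
    nςT {ℓ = _}             χ = ςT χ

    nς : TrS → List Synchron
    nς (trS (tr χ) _)  = nςT χ
    nς (emitS _ χ)     = ςE χ

    static : List Arg → List Arg
    static []           = []
    static (+L ∷ σ)     = static σ
    static (+R ∷ σ)     = static σ
    static (agA _ ∷ σ)  = static σ
    static (sigA _ ∷ σ) = static σ
    static (a ∷ σ)      = a ∷ static σ

    data Dir : Set where L R : Dir

    bar : Dir → Arg
    bar L = |L
    bar R = |R

    _▹_ : List Arg → Synchron → Synchron
    σ ▹ (τs , l) = (σ ++ τs , l)

    _⤳ˢ_ : Synchron → Synchron → Set₁
    x ⤳ˢ x' = (x' ≡ x) ⊎
      (Σ (List Arg) λ σ₁ → Σ Dir λ D → Σ Synchron λ x₂ →
        (x ≡ σ₁ ▹ (bar D ◂ x₂)) × (x' ≡ static σ₁ ▹ (bar D ◂ x₂)))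

    _⌣d_ : Synchron → Synchron → Set₁
    x ⌣d y = Σ (List Arg) λ σ₁ → Σ Dir λ D → Σ Dir λ E → Σ Synchron λ x₂ → Σ Synchron λ y₂ →
      (D ≢ E) × (x ≡ σ₁ ▹ (bar D ◂ x₂)) × (y ≡ σ₁ ▹ (bar E ◂ y₂))

    _⌣_ : Synchron → Synchron → Set₁
    x ⌣ y = Σ Synchron λ x₀ → Σ Synchron λ y₀ → (x₀ ⤳ˢ x) × (x₀ ⌣d y₀) × (y₀ ⤳ˢ y)

    _⤳_ : TrS → TrS → Set₁
    χ ⤳ χ' = (length (nς χ) ≡ length (nς χ')) ×
      (∀ ς' → ς' ∈ nς χ' → Σ Synchron λ ς → (ς ∈ nς χ) × (ς ⤳ˢ ς'))

    _⌣•_ : TrS → Tr → Set₁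
    χ ⌣• ζ = ∀ ς υ → ς ∈ nς χ → υ ∈ aς ζ → ς ⌣ υ

module Submission where

-- Transitivity reduces to transitivity of
-- the synchron relation ⤳ˢ, which is awkward to prove from its definition
-- (two splittings σ₁ ++ |D ∷ … of the same list must be compared).  We
-- therefore characterise a proper ⤳ˢ-step inductively as a relation
-- `Prunes` that walks down the argument string, deleting dynamic and keeping
-- static arguments until it stops at some |D; `Prunes` is plainly transitive.
--
-- For the last part we use the static skeleton of a synchron (its argument
-- string with dynamic arguments deleted).  ⤳ˢ preserves the skeleton, while
-- ⌣d forces the skeletons apart (they fork into |L and |R after a common
-- prefix); hence ς ⤳ˢ υ excludes ς ⌣ υ.  It then suffices that every
-- u ∈ Tr^• has a synchron that is both necessary and active: the
-- hypothesis t ⤳ u yields a necessary ς of t with ς ⤳ˢ υ, and t ⌣• u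
-- yields ς ⌣ υ.

open import Defs
open import Data.Product using (_×_)
open import Relation.Nullary using (¬_)

open import Data.Unit using (⊤; tt)
open import Data.Empty using (⊥)
open import Data.Bool using (Bool; true; false)
open import Data.Sum using (inj₁; inj₂)
open import Data.Product using (Σ; _,_; proj₁; proj₂)
open import Data.List using (List; []; _∷_; _++_)
open import Data.List.Membership.Propositional using (_∈_)
open import Data.List.Membership.Propositional.Properties using (∈-map⁺; ∈-++⁺ˡ; ∈-++⁺ʳ)
open import Data.List.Relation.Unary.Any using (here; there)
open import Data.List.Properties using (∷-injectiveˡ; ++-cancelˡ)
open import Relation.Binary.PropositionalEquality
  using (_≡_; _≢_; refl; sym; trans; cong; subst; module ≡-Reasoning)

module Proposition3 (𝒜 𝒞 ℬ 𝒮 : Set) (c : Calc) (def : 𝒜 → Calculus.Proc 𝒜 𝒞 ℬ 𝒮 c) where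
  open Calculus 𝒜 𝒞 ℬ 𝒮
  open Sem c def
  open Synchrons c def

  data IsDyn : Arg → Set₁ where
    +L : IsDyn +L
    +R : IsDyn +R
    ag : ∀ A → IsDyn (agA A)
    sg : ∀ r → IsDyn (sigA r)

  data IsStat : Arg → Set₁ where
    |L : IsStat |L
    |R : IsStat |R
    rs : ∀ N → IsStat (∖A N)
    rn : ∀ f → IsStat (renA f)

  dyn∧stat-impossible : ∀ {a} → IsDyn a → IsStat a → ⊥
  dyn∧stat-impossible +L ()
  dyn∧stat-impossible +R ()
  dyn∧stat-impossible (ag A) ()
  dyn∧stat-impossible (sg r) ()

  static-dyn : ∀ {a} σ → IsDyn a → static (a ∷ σ) ≡ static σ
  static-dyn σ +L = refl
  static-dyn σ +R = refl
  static-dyn σ (ag A) = refl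
  static-dyn σ (sg r) = refl

  static-stat : ∀ {a} σ → IsStat a → static (a ∷ σ) ≡ a ∷ static σ
  static-stat σ |L = refl
  static-stat σ |R = refl
  static-stat σ (rs N) = refl
  static-stat σ (rn f) = refl

  static-bar : ∀ D σ → static (bar D ∷ σ) ≡ bar D ∷ static σ
  static-bar L σ = refl
  static-bar R σ = refl

  static-++ : ∀ σ ρ → static (σ ++ ρ) ≡ static σ ++ static ρ
  static-++ [] ρ = refl
  static-++ (+L ∷ σ) ρ = static-++ σ ρ
  static-++ (+R ∷ σ) ρ = static-++ σ ρ
  static-++ (|L ∷ σ) ρ = cong (|L ∷_) (static-++ σ ρ)
  static-++ (|R ∷ σ) ρ = cong (|R ∷_) (static-++ σ ρ)
  static-++ (∖A N ∷ σ) ρ = cong (∖A N ∷_) (static-++ σ ρ)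
  static-++ (renA f ∷ σ) ρ = cong (renA f ∷_) (static-++ σ ρ)
  static-++ (agA A ∷ σ) ρ = static-++ σ ρ
  static-++ (sigA r ∷ σ) ρ = static-++ σ ρ

  static-idem : ∀ σ → static (static σ) ≡ static σ
  static-idem [] = refl
  static-idem (+L ∷ σ) = static-idem σ
  static-idem (+R ∷ σ) = static-idem σ
  static-idem (|L ∷ σ) = cong (|L ∷_) (static-idem σ)
  static-idem (|R ∷ σ) = cong (|R ∷_) (static-idem σ)
  static-idem (∖A N ∷ σ) = cong (∖A N ∷_) (static-idem σ)
  static-idem (renA f ∷ σ) = cong (renA f ∷_) (static-idem σ)
  static-idem (agA A ∷ σ) = static-idem σ
  static-idem (sigA r ∷ σ) = static-idem σ

  -- `Prunes σ σ'`: σ' arises from σ = σ₁ ++ |D ∷ ρ by deleting the dynamic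
  -- arguments of σ₁, i.e. σ' = static σ₁ ++ |D ∷ ρ.
  data Prunes : List Arg → List Arg → Set₁ where
    stop : ∀ D σ → Prunes (bar D ∷ σ) (bar D ∷ σ)
    drop : ∀ {a σ σ'} → IsDyn a → Prunes σ σ' → Prunes (a ∷ σ) σ'
    keep : ∀ {a σ σ'} → IsStat a → Prunes σ σ' → Prunes (a ∷ σ) (a ∷ σ')

  -- Pruning twice is pruning once: stop at the later of the two bars.
  Prunes-trans : ∀ {σ σ' σ''} → Prunes σ σ' → Prunes σ' σ'' → Prunes σ σ''
  Prunes-trans (stop D σ) q = q
  Prunes-trans (drop d p) q = drop d (Prunes-trans p q)
  Prunes-trans (keep s p) (stop D σ) = keep s p
  Prunes-trans (keep s p) (drop d q) with dyn∧stat-impossible d s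
  ... | ()
  Prunes-trans (keep s p) (keep _ q) = keep s (Prunes-trans p q)

  Prunes-split : ∀ σ₁ D ρ → Prunes (σ₁ ++ bar D ∷ ρ) (static σ₁ ++ bar D ∷ ρ)
  Prunes-split [] D ρ = stop D ρ
  Prunes-split (+L ∷ σ) D ρ = drop +L (Prunes-split σ D ρ)
  Prunes-split (+R ∷ σ) D ρ = drop +R (Prunes-split σ D ρ)
  Prunes-split (|L ∷ σ) D ρ = keep |L (Prunes-split σ D ρ)
  Prunes-split (|R ∷ σ) D ρ = keep |R (Prunes-split σ D ρ)
  Prunes-split (∖A N ∷ σ) D ρ = keep (rs N) (Prunes-split σ D ρ)
  Prunes-split (renA f ∷ σ) D ρ = keep (rn f) (Prunes-split σ D ρ)
  Prunes-split (agA A ∷ σ) D ρ = drop (ag A) (Prunes-split σ D ρ)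
  Prunes-split (sigA r ∷ σ) D ρ = drop (sg r) (Prunes-split σ D ρ)

  Split : List Arg → List Arg → Set₁
  Split σ σ' = Σ (List Arg) λ σ₁ → Σ Dir λ D → Σ (List Arg) λ ρ →
    (σ ≡ σ₁ ++ bar D ∷ ρ) × (σ' ≡ static σ₁ ++ bar D ∷ ρ)

  Prunes-unsplit : ∀ {σ σ'} → Prunes σ σ' → Split σ σ'
  Prunes-unsplit (stop D σ) = [] , D , σ , refl , refl
  Prunes-unsplit (drop {a} d p) with Prunes-unsplit p
  ... | σ₁ , D , ρ , refl , refl =
    a ∷ σ₁ , D , ρ , refl , cong (_++ bar D ∷ ρ) (sym (static-dyn σ₁ d))
  Prunes-unsplit (keep {a} s p) with Prunes-unsplit p
  ... | σ₁ , D , ρ , refl , refl =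
    a ∷ σ₁ , D , ρ , refl , cong (_++ bar D ∷ ρ) (sym (static-stat σ₁ s))

  Prunes⇒⤳ˢ : ∀ {σ σ' l} → Prunes σ σ' → (σ , l) ⤳ˢ (σ' , l)
  Prunes⇒⤳ˢ {l = l} p with Prunes-unsplit p
  ... | σ₁ , D , ρ , refl , refl = inj₂ (σ₁ , D , (ρ , l) , refl , refl)

  -- Proper steps compose as prunings; the leaf is never changed.
  ⤳ˢ-trans : ∀ {x y z} → x ⤳ˢ y → y ⤳ˢ z → x ⤳ˢ z
  ⤳ˢ-trans (inj₁ refl) q = q
  ⤳ˢ-trans p (inj₁ refl) = p
  ⤳ˢ-trans (inj₂ (σ₁ , D , x₂ , refl , refl)) (inj₂ (τ₁ , E , y₂ , y≡ , refl))
    with cong proj₂ y≡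
  ... | refl = Prunes⇒⤳ˢ (Prunes-trans (Prunes-split σ₁ D (proj₁ x₂))
                  (subst (λ y → Prunes (proj₁ y) _) (sym y≡) (Prunes-split τ₁ E (proj₁ y₂))))

  ⤳-refl : (χ : TrS) → χ ⤳ χ
  ⤳-refl χ = refl , λ ς ς∈ → ς , ς∈ , inj₁ refl

  ⤳-trans : (χ χ' χ'' : TrS) → χ ⤳ χ' → χ' ⤳ χ'' → χ ⤳ χ''
  ⤳-trans χ χ' χ'' (len₁ , back₁) (len₂ , back₂) = trans len₁ len₂ , back
    where
      back : ∀ ς'' → ς'' ∈ nς χ'' → Σ Synchron λ ς → (ς ∈ nς χ) × (ς ⤳ˢ ς'')
      back ς'' ς''∈ with back₂ ς'' ς''∈
      ... | ς' , ς'∈ , ς'⤳ς'' with back₁ ς' ς'∈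
      ... | ς , ς∈ , ς⤳ς' = ς , ς∈ , ⤳ˢ-trans ς⤳ς' ς'⤳ς''

  skeleton : Synchron → List Arg
  skeleton x = static (proj₁ x)

  skeleton-split : ∀ σ₁ D x₂ → skeleton (σ₁ ▹ (bar D ◂ x₂)) ≡ static σ₁ ++ bar D ∷ skeleton x₂
  skeleton-split σ₁ D x₂ = trans (static-++ σ₁ (bar D ∷ proj₁ x₂))
                                 (cong (static σ₁ ++_) (static-bar D (proj₁ x₂)))

  ⤳ˢ-skeleton : ∀ {x x'} → x ⤳ˢ x' → skeleton x ≡ skeleton x'
  ⤳ˢ-skeleton (inj₁ refl) = refl
  ⤳ˢ-skeleton (inj₂ (σ₁ , D , x₂ , refl , refl)) = begin
      skeleton (σ₁ ▹ (bar D ◂ x₂))                ≡⟨ skeleton-split σ₁ D x₂ ⟩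
      static σ₁ ++ bar D ∷ skeleton x₂            ≡⟨ cong (_++ bar D ∷ skeleton x₂) (sym (static-idem σ₁)) ⟩
      static (static σ₁) ++ bar D ∷ skeleton x₂   ≡⟨ sym (skeleton-split (static σ₁) D x₂) ⟩
      skeleton (static σ₁ ▹ (bar D ◂ x₂))         ∎
    where open ≡-Reasoning

  bar-injective : ∀ {D E} → bar D ≡ bar E → D ≡ E
  bar-injective {L} {L} _ = refl
  bar-injective {R} {R} _ = refl

  ⌣d-skeleton : ∀ {x y} → x ⌣d y → skeleton x ≢ skeleton y
  ⌣d-skeleton (σ₁ , D , E , x₂ , y₂ , D≢E , refl , refl) same =
    D≢E (bar-injective (∷-injectiveˡ (++-cancelˡ (static σ₁) _ _ forked)))
    where
      forked : static σ₁ ++ bar D ∷ skeleton x₂ ≡ static σ₁ ++ bar E ∷ skeleton y₂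
      forked = trans (sym (skeleton-split σ₁ D x₂)) (trans same (skeleton-split σ₁ E y₂))

  ⤳ˢ-excludes-⌣ : ∀ {ς υ} → ς ⤳ˢ υ → ¬ (ς ⌣ υ)
  ⤳ˢ-excludes-⌣ ς⤳υ (x₀ , y₀ , x₀⤳ς , x₀⌣dy₀ , y₀⤳υ) =
    ⌣d-skeleton x₀⌣dy₀ (trans (⤳ˢ-skeleton x₀⤳ς)
                          (trans (⤳ˢ-skeleton ς⤳υ) (sym (⤳ˢ-skeleton y₀⤳υ))))

  Has : (Leaf → Bool) → List Synchron → Set₁
  Has p xs = Σ Synchron λ υ → (υ ∈ xs) × (p (proj₂ υ) ≡ true)

  Has-◂ : ∀ {p xs} a → Has p xs → Has p (a ◂* xs)
  Has-◂ a (υ , υ∈ , pυ) = a ◂ υ , ∈-map⁺ (a ◂_) υ∈ , pυ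

  Has-++ˡ : ∀ {p xs} ys → Has p xs → Has p (xs ++ ys)
  Has-++ˡ ys (υ , υ∈ , pυ) = υ , ∈-++⁺ˡ υ∈ , pυ

  Has-++ʳ : ∀ {p ys} xs → Has p ys → Has p (xs ++ ys)
  Has-++ʳ xs (υ , υ∈ , pυ) = υ , ∈-++⁺ʳ xs υ∈ , pυ

  ∈-filterS : ∀ p {υ xs} → υ ∈ xs → p (proj₂ υ) ≡ true → υ ∈ filterS p xs
  ∈-filterS p {xs = (σ , l) ∷ xs} (here refl) pυ rewrite pυ = here refl
  ∈-filterS p {xs = (σ , l) ∷ xs} (there υ∈) pυ with p l
  ... | true  = there (∈-filterS p υ∈ pυ)
  ... | false = ∈-filterS p υ∈ pυ

  IsAct : Lab c → Set
  IsAct (act _) = ⊤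
  IsAct _       = ⊥

  IsOut : Lab c → Set
  IsOut (act (out _ _)) = ⊤
  IsOut _               = ⊥

  IsAct-renLab : ∀ f ℓ → IsAct (renLab f ℓ) → IsAct ℓ
  IsAct-renLab f (act α) _ = tt

  IsOut-renLab : ∀ f ℓ → IsOut (renLab f ℓ) → IsOut ℓ
  IsOut-renLab f (act (out h b)) _ = tt

  -- A derivation of an action has an active synchron: follow a premise
  -- with an action label down to a prefix axiom.
  active-synchron : ∀ {P ℓ P'} (χ : Step P ℓ P') → IsAct ℓ → Has isPre (ςT χ)
  active-synchron (pre α P) _ = ([] , preL α P) , here refl , refl
  active-synchron (sumL χ Q) i = Has-◂ +L (active-synchron χ i)
  active-synchron (sumR P χ) i = Has-◂ +R (active-synchron χ i)
  active-synchron (parL χ _ Q) i = Has-◂ |L (active-synchron χ i)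
  active-synchron (parR P χ _) i = Has-◂ |R (active-synchron χ i)
  active-synchron (comL χ ζ) _ = Has-++ˡ _ (Has-◂ |L (active-synchron χ tt))
  active-synchron (comR χ ζ) _ = Has-++ˡ _ (Has-◂ |L (active-synchron χ tt))
  active-synchron (comSL χ ζ) _ = Has-++ˡ _ (Has-◂ |L (active-synchron χ tt))
  active-synchron (comSR χ ζ) _ = Has-++ʳ _ (Has-◂ |R (active-synchron ζ tt))
  active-synchron (res χ N _) i = Has-◂ (∖A N) (active-synchron χ i)
  active-synchron (rn {ℓ = ℓ} χ f) i = Has-◂ (renA f) (active-synchron χ (IsAct-renLab f ℓ i))
  active-synchron (ag A χ) i = Has-◂ (agA A) (active-synchron χ i)
  active-synchron (bcOutL _ χ Q _) _ = Has-◂ |L (active-synchron χ tt)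
  active-synchron (bcInpL _ χ Q _) _ = Has-◂ |L (active-synchron χ tt)
  active-synchron (bcOutR _ P ζ _) _ = Has-◂ |R (active-synchron ζ tt)
  active-synchron (bcInpR _ P ζ _) _ = Has-◂ |R (active-synchron ζ tt)
  active-synchron (bsync χ ζ !?) _ = Has-++ˡ _ (Has-◂ |L (active-synchron χ tt))
  active-synchron (bsync χ ζ ?!) _ = Has-++ˡ _ (Has-◂ |L (active-synchron χ tt))
  active-synchron (bsync χ ζ ??) _ = Has-++ˡ _ (Has-◂ |L (active-synchron χ tt))
  active-synchron (bsync χ ζ !:) _ = Has-++ˡ _ (Has-◂ |L (active-synchron χ tt))
  active-synchron (bsync χ ζ :!) _ = Has-++ʳ _ (Has-◂ |R (active-synchron ζ tt))
  active-synchron (bsync χ ζ ?:) _ = Has-++ˡ _ (Has-◂ |L (active-synchron χ tt))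
  active-synchron (bsync χ ζ :?) _ = Has-++ʳ _ (Has-◂ |R (active-synchron ζ tt))
  active-synchron (sigα χ r) i = Has-◂ (sigA r) (active-synchron χ i)
  active-synchron (sigSL _ e ζ) _ = Has-++ʳ _ (Has-◂ |R (active-synchron ζ tt))
  active-synchron (sigSR _ χ e) _ = Has-++ˡ _ (Has-◂ |L (active-synchron χ tt))

  output-synchron : ∀ {P ℓ P'} (χ : Step P ℓ P') → IsOut ℓ → Has isOutPre (ςT χ)
  output-synchron (pre (out h b) P) _ = ([] , preL (out h b) P) , here refl , refl
  output-synchron (sumL χ Q) o = Has-◂ +L (output-synchron χ o)
  output-synchron (sumR P χ) o = Has-◂ +R (output-synchron χ o)
  output-synchron (parL χ _ Q) o = Has-◂ |L (output-synchron χ o)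
  output-synchron (parR P χ _) o = Has-◂ |R (output-synchron χ o)
  output-synchron (res χ N _) o = Has-◂ (∖A N) (output-synchron χ o)
  output-synchron (rn {ℓ = ℓ} χ f) o = Has-◂ (renA f) (output-synchron χ (IsOut-renLab f ℓ o))
  output-synchron (ag A χ) o = Has-◂ (agA A) (output-synchron χ o)
  output-synchron (bcOutL _ χ Q _) _ = Has-◂ |L (output-synchron χ tt)
  output-synchron (bcOutR _ P ζ _) _ = Has-◂ |R (output-synchron ζ tt)
  output-synchron (bsync χ ζ !?) _ = Has-++ˡ _ (Has-◂ |L (output-synchron χ tt))
  output-synchron (bsync χ ζ ?!) _ = Has-++ʳ _ (Has-◂ |R (output-synchron ζ tt))
  output-synchron (bsync χ ζ !:) _ = Has-++ˡ _ (Has-◂ |L (output-synchron χ tt))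
  output-synchron (bsync χ ζ :!) _ = Has-++ʳ _ (Has-◂ |R (output-synchron ζ tt))
  output-synchron (sigα χ r) o = Has-◂ (sigA r) (output-synchron χ o)

  -- For outputs, nς keeps exactly the b!-prefix synchrons, which are active;
  -- for the other labels of Tr^•, nς is all of ς and we take an active one.
  necessary-active : ∀ {P ℓ P'} (χ : Step P ℓ P') → Bullet ℓ →
    Σ Synchron λ υ → (υ ∈ nςT χ) × (υ ∈ aς (tr χ))
  necessary-active {ℓ = act (out h b)} χ _ with output-synchron χ tt
  ... | (σ , preL α P) , υ∈ , isOut = _ , ∈-filterS isOutPre υ∈ isOut , ∈-filterS isPre υ∈ refl
  necessary-active {ℓ = act (ch a)} χ _ with active-synchron χ tt
  ... | υ , υ∈ , isP = υ , υ∈ , ∈-filterS isPre υ∈ isP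
  necessary-active {ℓ = act (co a)} χ _ with active-synchron χ tt
  ... | υ , υ∈ , isP = υ , υ∈ , ∈-filterS isPre υ∈ isP
  necessary-active {ℓ = act τ} χ _ with active-synchron χ tt
  ... | υ , υ∈ , isP = υ , υ∈ , ∈-filterS isPre υ∈ isP
  necessary-active {ℓ = act (sg h s)} χ _ with active-synchron χ tt
  ... | υ , υ∈ , isP = υ , υ∈ , ∈-filterS isPre υ∈ isP

  ⤳-excludes-⌣• : (t u : TrB) → ¬ ((TrB→TrS t ⤳ TrB→TrS u) × (TrB→TrS t ⌣• TrB.t u))
  ⤳-excludes-⌣• t (trB (tr χ) u∈Tr•) ((_ , back) , concurrent)
    with necessary-active χ u∈Tr•
  ... | υ , υ∈nς , υ∈aς with back υ υ∈nς
  ... | ς , ς∈nς , ς⤳υ = ⤳ˢ-excludes-⌣ ς⤳υ (concurrent ς υ ς∈nς υ∈aς)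

proposition3 : (𝒜 𝒞 ℬ 𝒮 : Set) (c : Calc) (def : 𝒜 → Calculus.Proc 𝒜 𝒞 ℬ 𝒮 c) →
    Calculus.GuardHyp 𝒜 𝒞 ℬ 𝒮 c def →
    let open Calculus 𝒜 𝒞 ℬ 𝒮
        open Sem c def
        open Synchrons c def
    in ((χ : TrS) → χ ⤳ χ)
       × ((χ χ' χ'' : TrS) → χ ⤳ χ' → χ' ⤳ χ'' → χ ⤳ χ'')
       × ((t u : TrB) → ¬ ((TrB→TrS t ⤳ TrB→TrS u) × (TrB→TrS t ⌣• TrB.t u)))
proposition3 𝒜 𝒞 ℬ 𝒮 c def _ = ⤳-refl , ⤳-trans , ⤳-excludes-⌣•
  where open Proposition3 𝒜 𝒞 ℬ 𝒮 c def
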